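{- Let $R$ be a commutative ring and $h=(h_n)_{n>0}$ a sequence in $R$ such that $h_1$ is not a zero-divisor and $h$ satisfies $E(m,n,1,0)$ for all integers $m>n>1$. Then $h$ is elliptic, i.e. $h$ satisfies $E(a,b,c,d)$ for all integers $a>b>c>d\ge 0$.
   Context: For a sequence $h=(h_n)_{n>0}$ in a commutative ring and integers $a>b>c>d\ge0$, the elliptic relation $E(a,b,c,d)$ is the identity $$h_{a+b}h_{a-b}h_{c+d}h_{c-d}=h_{a+c}h_{a-c}h_{b+d}h_{b-d}-h_{b+c}h_{b-c}h_{a+d}h_{a-d}.$$ A sequence $(h_n)_{n>0}$ is called elliptic if it satisfies $E(a,b,c,d)$ for all integers $a>b>c>d\ge0$. In particular $E(m,n,1,0)$ reads $h_{m+n}h_{m-n}h_1^2=h_{m+1}h_{m-1}h_n^2-h_{n+1}h_{n-1}h_m^2$. -}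

module Defs where

open import Level using (Level)
open import Data.Nat using (ℕ; _+_; _∸_; _<_)
open import Algebra.Bundles using (CommutativeRing)

-- Sequences h = (h_n)_{n>0} are modelled as functions ℕ → R; the value at
-- index 0 is irrelevant (never used below, since a > b > c > d ≥ 0 forces
-- every index occurring in E(a,b,c,d) to be positive).
-- Subtraction is truncated (∸) but is only applied when the result is exact.

module _ {c ℓ : Level} (R : CommutativeRing c ℓ) where
  open CommutativeRing R using (Carrier; _≈_; _*_; _-_; 0#)

  NonZeroDivisor : Carrier → Set (c Level.⊔ ℓ)
  NonZeroDivisor x = ∀ y → x * y ≈ 0# → y ≈ 0#

  E : (ℕ → Carrier) → ℕ → ℕ → ℕ → ℕ → Set ℓ
  E h a b c' d =
    h (a + b) * h (a ∸ b) * h (c' + d) * h (c' ∸ d)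
      ≈ h (a + c') * h (a ∸ c') * h (b + d) * h (b ∸ d)
        - h (b + c') * h (b ∸ c') * h (a + d) * h (a ∸ d)

  Elliptic : (ℕ → Carrier) → Set ℓ
  Elliptic h = ∀ a b c' d → b < a → c' < b → d < c' → E h a b c' d

{-# OPTIONS --safe #-}
module Submission where

open import Defs
open import Level using (Level)
open import Data.Nat using (ℕ; zero; suc; _<_; s≤s; z≤n)
import Data.Nat as ℕ
import Data.Nat.Properties as ℕ
open import Data.Integer using (ℤ; +_; -[1+_]; _⊖_; _◃_; +-*-rawRing)
import Data.Integer as ℤ
open import Data.Integer.Properties using ([1+m]⊖[1+n]≡m⊖n)
open import Data.Sign using (Sign)
open import Data.Maybe using (just; nothing)
open import Relation.Nullary using (yes; no)
open import Relation.Binary.Definitions using (WeaklyDecidable)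
import Relation.Binary.PropositionalEquality as ≡
open import Algebra.Bundles using (CommutativeRing)
open import Algebra.Solver.Ring.AlmostCommutativeRing
  using (_-Raw-AlmostCommutative⟶_; fromCommutativeRing)
import Algebra.Solver.Ring

-- With P = h₁², the hypothesis E(m,n,1,0) says that P h_{m+n} h_{m-n} is the
-- 2×2 minor det(v_m, v_n) of the vectors v_n = (h_{n+1} h_{n-1}, h_n²).
-- Hence P² times either side of E(a,b,c,d) is the corresponding side of the
-- three-term Plücker relation among v_a, v_b, v_c, v_d, which holds in every
-- commutative ring, and P² cancels because h₁ is not a zero-divisor.

-- The ring solver only detects cancellations between coefficients it can
-- compare, so coefficients are taken in ℤ and mapped into R.
module IntegerCoefficients {c ℓ : Level} (R : CommutativeRing c ℓ) where
  open CommutativeRing R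
  open import Algebra.Properties.Ring ring
    using (-0#≈0#; -‿involutive; -‿+-comm; -‿distribˡ-*; -‿distribʳ-*)
  open import Algebra.Properties.CommutativeSemigroup +-commutativeSemigroup
    using (interchange)
  open import Algebra.Properties.Semiring.Mult semiring using (_×_; ×-homo-+; ×1-homo-*)
  open import Relation.Binary.Reasoning.Setoid setoid

  fromℕ : ℕ → Carrier
  fromℕ n = n × 1#

  fromℤ : ℤ → Carrier
  fromℤ (+ n)    = fromℕ n
  fromℤ -[1+ n ] = - fromℕ (suc n)

  1+x-[1+y]≈x-y : ∀ x y → (1# + x) - (1# + y) ≈ x - y
  1+x-[1+y]≈x-y x y = begin
    (1# + x) + - (1# + y)    ≈⟨ +-congˡ (-‿+-comm 1# y) ⟨
    (1# + x) + (- 1# + - y)  ≈⟨ interchange 1# x (- 1#) (- y) ⟩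
    (1# + - 1#) + (x - y)    ≈⟨ +-congʳ (-‿inverseʳ 1#) ⟩
    0# + (x - y)             ≈⟨ +-identityˡ (x - y) ⟩
    x - y                    ∎

  fromℤ-⊖ : ∀ m n → fromℤ (m ⊖ n) ≈ fromℕ m - fromℕ n
  fromℤ-⊖ zero    zero    = sym (-‿inverseʳ 0#)
  fromℤ-⊖ (suc m) zero    = sym (trans (+-congˡ -0#≈0#) (+-identityʳ _))
  fromℤ-⊖ zero    (suc n) = sym (+-identityˡ _)
  fromℤ-⊖ (suc m) (suc n) rewrite [1+m]⊖[1+n]≡m⊖n m n =
    trans (fromℤ-⊖ m n) (sym (1+x-[1+y]≈x-y (fromℕ m) (fromℕ n)))

  fromℤ-+ : ∀ i j → fromℤ (i ℤ.+ j) ≈ fromℤ i + fromℤ j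
  fromℤ-+ (+ m)    (+ n)    = ×-homo-+ 1# m n
  fromℤ-+ (+ m)    -[1+ n ] = fromℤ-⊖ m (suc n)
  fromℤ-+ -[1+ m ] (+ n)    = trans (fromℤ-⊖ n (suc m)) (+-comm _ _)
  fromℤ-+ -[1+ m ] -[1+ n ] = begin
    - fromℕ (suc (suc (m ℕ.+ n)))       ≈⟨ -‿cong (reflexive (≡.cong fromℕ (ℕ.+-suc (suc m) n))) ⟨
    - fromℕ (suc m ℕ.+ suc n)           ≈⟨ -‿cong (×-homo-+ 1# (suc m) (suc n)) ⟩
    - (fromℕ (suc m) + fromℕ (suc n))   ≈⟨ -‿+-comm _ _ ⟨
    - fromℕ (suc m) + - fromℕ (suc n)   ∎

  fromℤ-neg : ∀ i → fromℤ (ℤ.- i) ≈ - fromℤ i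
  fromℤ-neg (+ zero)  = sym -0#≈0#
  fromℤ-neg (+ suc n) = refl
  fromℤ-neg -[1+ n ]  = sym (-‿involutive _)

  fromℤ-+◃ : ∀ n → fromℤ (Sign.+ ◃ n) ≈ fromℕ n
  fromℤ-+◃ zero    = refl
  fromℤ-+◃ (suc n) = refl

  fromℤ--◃ : ∀ n → fromℤ (Sign.- ◃ n) ≈ - fromℕ n
  fromℤ--◃ zero    = sym -0#≈0#
  fromℤ--◃ (suc n) = refl

  fromℤ-* : ∀ i j → fromℤ (i ℤ.* j) ≈ fromℤ i * fromℤ j
  fromℤ-* (+ m)    (+ n)    = trans (fromℤ-+◃ (m ℕ.* n)) (×1-homo-* m n)
  fromℤ-* (+ m)    -[1+ n ] =
    trans (fromℤ--◃ (m ℕ.* suc n)) (trans (-‿cong (×1-homo-* m (suc n))) (-‿distribʳ-* _ _))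
  fromℤ-* -[1+ m ] (+ n)    =
    trans (fromℤ--◃ (suc m ℕ.* n)) (trans (-‿cong (×1-homo-* (suc m) n)) (-‿distribˡ-* _ _))
  fromℤ-* -[1+ m ] -[1+ n ] = begin
    fromℤ (Sign.+ ◃ suc m ℕ.* suc n)            ≈⟨ fromℤ-+◃ (suc m ℕ.* suc n) ⟩
    fromℕ (suc m ℕ.* suc n)                     ≈⟨ ×1-homo-* (suc m) (suc n) ⟩
    fromℕ (suc m) * fromℕ (suc n)               ≈⟨ -‿involutive _ ⟨
    - - (fromℕ (suc m) * fromℕ (suc n))         ≈⟨ -‿cong (-‿distribˡ-* _ _) ⟩
    - (- fromℕ (suc m) * fromℕ (suc n))         ≈⟨ -‿distribʳ-* _ _ ⟩
    - fromℕ (suc m) * - fromℕ (suc n)           ∎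

  fromℤ-homomorphism : +-*-rawRing -Raw-AlmostCommutative⟶ fromCommutativeRing R
  fromℤ-homomorphism = record
    { ⟦_⟧    = fromℤ
    ; +-homo = fromℤ-+
    ; *-homo = fromℤ-*
    ; -‿homo = fromℤ-neg
    ; 0-homo = refl
    ; 1-homo = +-identityʳ 1#
    }

  fromℤ-≟ : WeaklyDecidable (λ i j → fromℤ i ≈ fromℤ j)
  fromℤ-≟ i j with i ℤ.≟ j
  ... | yes ≡.refl = just refl
  ... | no _       = nothing

  open Algebra.Solver.Ring +-*-rawRing (fromCommutativeRing R) fromℤ-homomorphism fromℤ-≟ public
    using (solve; _:=_; _:*_; _:-_; :-_; con)

module Minors {c ℓ : Level} (R : CommutativeRing c ℓ) where
  open CommutativeRing R
  open IntegerCoefficients R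
  open import Algebra.Properties.Ring ring using (x[y-z]≈xy-xz; x∙y⁻¹≈ε⇒x≈y; x≈y⇒x∙y⁻¹≈ε)
  open import Relation.Binary.Reasoning.Setoid setoid

  NonZeroDivisor-* : ∀ {g g′} → NonZeroDivisor R g → NonZeroDivisor R g′ → NonZeroDivisor R (g * g′)
  NonZeroDivisor-* {g} {g′} g-regular g′-regular z gg′z≈0 =
    g′-regular z (g-regular (g′ * z) (trans (sym (*-assoc g g′ z)) gg′z≈0))

  NonZeroDivisor-cancelˡ : ∀ {g x y} → NonZeroDivisor R g → g * x ≈ g * y → x ≈ y
  NonZeroDivisor-cancelˡ {g} {x} {y} g-regular gx≈gy =
    x∙y⁻¹≈ε⇒x≈y x y (g-regular (x - y) (trans (x[y-z]≈xy-xz g x y) (x≈y⇒x∙y⁻¹≈ε gx≈gy)))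

  minor : (ℕ → Carrier) → (ℕ → Carrier) → ℕ → ℕ → Carrier
  minor y x i j = y i * x j - y j * x i

  minor-plücker : ∀ y x a b c d →
    minor y x a b * minor y x c d ≈ minor y x a c * minor y x b d - minor y x b c * minor y x a d
  minor-plücker y x a b c d = solve 8
    (λ ya yb yc yd xa xb xc xd →
      (ya :* xb :- yb :* xa) :* (yc :* xd :- yd :* xc)
        := (ya :* xc :- yc :* xa) :* (yb :* xd :- yd :* xb)
           :- (yb :* xc :- yc :* xb) :* (ya :* xd :- yd :* xa))
    refl (y a) (y b) (y c) (y d) (x a) (x b) (x c) (x d)

  scaled-plücker : ∀ P y x (F : ℕ → ℕ → Carrier) →
    (∀ {i j} → j < i → P * F i j ≈ minor y x i j) →
    ∀ {a b c d} → b < a → c < b → d < c →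
    P * P * (F a b * F c d) ≈ P * P * (F a c * F b d - F b c * F a d)
  scaled-plücker P y x F P*F≈minor {a} {b} {c} {d} b<a c<b d<c = begin
    P * P * (F a b * F c d)
      ≈⟨ solve 3 (λ p u v → p :* p :* (u :* v) := (p :* u) :* (p :* v)) refl P (F a b) (F c d) ⟩
    (P * F a b) * (P * F c d)
      ≈⟨ *-cong (P*F≈minor b<a) (P*F≈minor d<c) ⟩
    minor y x a b * minor y x c d
      ≈⟨ minor-plücker y x a b c d ⟩
    minor y x a c * minor y x b d - minor y x b c * minor y x a d
      ≈⟨ +-cong (*-cong (P*F≈minor a>c) (P*F≈minor b>d))
                (-‿cong (*-cong (P*F≈minor c<b) (P*F≈minor a>d))) ⟨
    (P * F a c) * (P * F b d) - (P * F b c) * (P * F a d)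
      ≈⟨ solve 5 (λ p s t u v → (p :* s) :* (p :* t) :- (p :* u) :* (p :* v)
                                  := p :* p :* (s :* t :- u :* v))
                 refl P (F a c) (F b d) (F b c) (F a d) ⟩
    P * P * (F a c * F b d - F b c * F a d) ∎
    where
    a>c : c < a
    a>c = ℕ.<-trans c<b b<a
    b>d : d < b
    b>d = ℕ.<-trans d<c c<b
    a>d : d < a
    a>d = ℕ.<-trans b>d b<a

module AdditionFormula {c ℓ : Level} (R : CommutativeRing c ℓ) (h : ℕ → CommutativeRing.Carrier R) where
  open CommutativeRing R hiding (zero)
  open IntegerCoefficients R
  open Minors R using (minor)
  open import Relation.Binary.Reasoning.Setoid setoid

  h± : ℕ → ℕ → Carrier
  h± a b = h (a ℕ.+ b) * h (a ℕ.∸ b)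

  E-fromGrouped : ∀ a b c′ d →
    h± a b * h± c′ d ≈ h± a c′ * h± b d - h± b c′ * h± a d → E R h a b c′ d
  E-fromGrouped _ _ _ _ grouped =
    trans (*-assoc _ _ _)
      (trans grouped (sym (+-cong (*-assoc _ _ _) (-‿cong (*-assoc _ _ _)))))

  -- The rows (y n, x n) are (h_{n+1} h_{n-1}, h_n²) for the odd extension
  -- of h to ℤ with h 0 = 0; this is what fixes y 0 = - h₁², y 1 = 0 and x 0 = 0.
  h₀ : ℕ → Carrier
  h₀ zero    = 0#
  h₀ (suc n) = h (suc n)

  y : ℕ → Carrier
  y zero    = - (h 1 * h 1)
  y (suc n) = h (suc n ℕ.+ 1) * h₀ n

  x : ℕ → Carrier
  x n = h₀ n * h₀ n

  h-+0 : ∀ n → h (n ℕ.+ 0) ≈ h n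
  h-+0 n = reflexive (≡.cong h (ℕ.+-identityʳ n))

  addition-formula : (∀ m n → n < m → 1 < n → E R h m n 1 0) →
    ∀ {a b} → b < a → h 1 * h 1 * h± a b ≈ minor y x a b
  addition-formula _ {suc a} {zero} _ = begin
    h 1 * h 1 * (h (suc a ℕ.+ 0) * h (suc a))  ≈⟨ *-congˡ (*-congʳ (h-+0 (suc a))) ⟩
    h 1 * h 1 * (h (suc a) * h (suc a))        ≈⟨ solve 3
      (λ g u w → g :* g :* (u :* u) := w :* (con (+ 0) :* con (+ 0)) :- (:- (g :* g)) :* (u :* u))
      refl (h 1) (h (suc a)) (y (suc a)) ⟩
    minor y x (suc a) zero                     ∎
  addition-formula _ {suc zero} {suc b} (s≤s ())
  addition-formula _ {a@(suc (suc _))} {suc zero} _ = solve 5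
    (λ g u v w s → g :* g :* (u :* v) := u :* v :* (g :* g) :- (w :* con (+ 0)) :* s)
    refl (h 1) (h (a ℕ.+ 1)) (h (a ℕ.∸ 1)) (h 2) (x a)
  addition-formula E[m,n,1,0] {a@(suc (suc _))} {b@(suc (suc _))} b<a = begin
    h 1 * h 1 * h± a b
      ≈⟨ solve 2 (λ g u → g :* g :* u := u :* g :* g) refl (h 1) (h± a b) ⟩
    h± a b * h 1 * h 1
      ≈⟨ E[m,n,1,0] a b b<a (s≤s (s≤s z≤n)) ⟩
    h (a ℕ.+ 1) * h (a ℕ.∸ 1) * h (b ℕ.+ 0) * h b - h (b ℕ.+ 1) * h (b ℕ.∸ 1) * h (a ℕ.+ 0) * h a
      ≈⟨ +-cong (*-congʳ (*-congˡ (h-+0 b))) (-‿cong (*-congʳ (*-congˡ (h-+0 a)))) ⟩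
    h (a ℕ.+ 1) * h (a ℕ.∸ 1) * h b * h b - h (b ℕ.+ 1) * h (b ℕ.∸ 1) * h a * h a
      ≈⟨ +-cong (*-assoc _ _ _) (-‿cong (*-assoc _ _ _)) ⟩
    minor y x a b ∎

corollary2p2 : ∀ {c ℓ : Level} (R : CommutativeRing c ℓ) (h : ℕ → CommutativeRing.Carrier R)
    → NonZeroDivisor R (h 1)
    → (∀ m n → n < m → 1 < n → E R h m n 1 0)
    → Elliptic R h
corollary2p2 R h h₁-regular E[m,n,1,0] a b c d b<a c<b d<c =
  E-fromGrouped a b c d (NonZeroDivisor-cancelˡ h₁⁴-regular
    (scaled-plücker h₁² y x h± (addition-formula E[m,n,1,0]) b<a c<b d<c))
  where
  open CommutativeRing R using (Carrier; _*_)
  open Minors R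
  open AdditionFormula R h

  h₁² : Carrier
  h₁² = h 1 * h 1

  h₁²-regular : NonZeroDivisor R h₁²
  h₁²-regular = NonZeroDivisor-* h₁-regular h₁-regular

  h₁⁴-regular : NonZeroDivisor R (h₁² * h₁²)
  h₁⁴-regular = NonZeroDivisor-* h₁²-regular h₁²-regular
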